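{- Let $\mathcal{F}$ be a filter on $\omega$. Then in each of the following pairs the two games are dual to each other: (1) $\mathfrak{G}(\mathcal{F}^+,\omega,\mathcal{F})$ and $\mathfrak{G}(\mathcal{F},\omega,\mathcal{F}^c)$; (2) $\mathfrak{G}(\mathcal{F}^+,\omega,\mathcal{F}^+)$ and $\mathfrak{G}(\mathcal{F},\omega,\mathcal{F}^*)$; (3) $\mathfrak{G}(\mathcal{F}^+,\omega,\mathcal{F}^c)$ and $\mathfrak{G}(\mathcal{F},\omega,\mathcal{F})$; (4) $\mathfrak{G}(\mathcal{F}^+,\omega,\mathcal{F}^*)$ and $\mathfrak{G}(\mathcal{F},\omega,\mathcal{F}^+)$.
   Context: A filter on $\omega$ is a family $\mathcal{F}\subseteq\mathcal{P}(\omega)$ closed under finite intersections and supersets and containing all cofinite subsets of $\omega$. $\mathcal{F}^+=\{X\subseteq\omega: X\cap Y\text{ infinite for all }Y\in\mathcal{F}\}$, $\mathcal{F}^c=\mathcal{P}(\omega)\setminus\mathcal{F}$, $\mathcal{F}^*=\mathcal{P}(\omega)\setminus\mathcal{F}^+$. For $\mathcal{X},\mathcal{Z}\subseteq\mathcal{P}(\omega)$, the game $\mathfrak{G}(\mathcal{X},\omega,\mathcal{Z})$: at each stage $k<\omega$ player I chooses $X_k\in\mathcal{X}$ and player II responds with $n_k\in X_k$; II wins if $\{n_k:k\in\omega\}\in\mathcal{Z}$, otherwise I wins. Two games are dual if for each player, that player has a winning strategy in one game if and only if the other player has a winning strategy in the other game. -}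

module Defs where

open import Level using (Level; 0ℓ) renaming (suc to lsuc)
open import Data.Nat using (ℕ; zero; suc; _≤_)
open import Data.List using (List; []; _∷_; _++_; [_])
open import Data.Product using (Σ; _×_; _,_; proj₁; proj₂)
open import Relation.Nullary using (¬_)
open import Relation.Binary.PropositionalEquality using (_≡_)
open import Function.Bundles using (_⇔_)

Subset : Set₁
Subset = ℕ → Set

Family : Set₂
Family = Subset → Set₁

_∩_ : Subset → Subset → Subset
(X ∩ Y) n = X n × Y n

_⊆_ : Subset → Subset → Set
X ⊆ Y = ∀ n → X n → Y n

Infinite : Subset → Set
Infinite X = ∀ m → Σ ℕ λ n → m ≤ n × X n

Cofinite : Subset → Set
Cofinite X = Σ ℕ λ m → ∀ n → m ≤ n → X n

record IsFilter (𝓕 : Family) : Set₂ where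
  field
    ∩-closed  : ∀ X Y → 𝓕 X → 𝓕 Y → 𝓕 (X ∩ Y)
    ⊇-closed  : ∀ X Y → X ⊆ Y → 𝓕 X → 𝓕 Y
    cofinite  : ∀ X → Cofinite X → 𝓕 X

Plus : Family → Family
Plus 𝓕 X = ∀ Y → 𝓕 Y → Infinite (X ∩ Y)

Compl : Family → Family
Compl 𝓕 X = ¬ 𝓕 X

Star : Family → Family
Star 𝓕 X = ¬ Plus 𝓕 X

Move : Family → Set₁
Move 𝒳 = Σ Subset 𝒳

prefix : {A : Set₁} → (ℕ → A) → ℕ → List A
prefix s zero = []
prefix s (suc k) = prefix s k ++ [ s k ]

prefixℕ : (ℕ → ℕ) → ℕ → List ℕ
prefixℕ s zero = []
prefixℕ s (suc k) = prefixℕ s k ++ [ s k ]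

Range : (ℕ → ℕ) → Subset
Range n m = Σ ℕ λ k → n k ≡ m

StrategyI : Family → Set₁
StrategyI 𝒳 = List ℕ → Move 𝒳

StrategyII : Family → Set₁
StrategyII 𝒳 = List (Move 𝒳) → (x : Move 𝒳) → Σ ℕ (proj₁ x)

IWins : Family → Family → Set₁
IWins 𝒳 𝒵 = Σ (StrategyI 𝒳) λ σ →
  (n : ℕ → ℕ) → (∀ k → proj₁ (σ (prefixℕ n k)) (n k)) → ¬ 𝒵 (Range n)

IIWins : Family → Family → Set₁
IIWins 𝒳 𝒵 = Σ (StrategyII 𝒳) λ τ →
  (xs : ℕ → Move 𝒳) → 𝒵 (Range (λ k → proj₁ (τ (prefix xs k) (xs k))))

Dual : Family → Family → Family → Family → Set₁
Dual 𝒳₁ 𝒵₁ 𝒳₂ 𝒵₂ =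
  (IWins 𝒳₁ 𝒵₁ ⇔ IIWins 𝒳₂ 𝒵₂) × (IIWins 𝒳₁ 𝒵₁ ⇔ IWins 𝒳₂ 𝒵₂)

-- A winning strategy in one game of a pair is transported to the other game, where the
-- opposite player uses it. If σ wins for I in 𝔊(𝒳, ω, 𝒵) and every set of 𝒳 meets every
-- set of 𝒴, then II answers a move Y of 𝔊(𝒴, ω, 𝒲) by a point of σ(history) ∩ Y; the
-- resulting play is a play of σ, so its range lies outside 𝒵, hence in 𝒲. If τ wins for
-- II in 𝔊(𝒴, ω, 𝒲), then I plays the set of all answers τ could give in the current
-- position; every number II picks from it is τ's answer to some move Y, so the play is a
-- play of τ and its range lies in 𝒲, hence outside 𝒵. For {𝒳, 𝒴} = {𝓕⁺, 𝓕} both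
-- transfers apply: sets of 𝓕⁺ meet sets of 𝓕, the answer set of a choice function on 𝓕
-- is in 𝓕⁺ (ask it about the tails of a set in 𝓕), and the answer set of a choice
-- function on 𝓕⁺ is in 𝓕 (its complement cannot be in 𝓕⁺, as it would have to be
-- answered inside itself). The payoffs come in complementary pairs 𝓕/𝓕ᶜ and 𝓕⁺/𝓕*.
module Submission where

open import Defs
open import Level using (0ℓ) renaming (suc to lsuc)
open import Axiom.ExcludedMiddle using (ExcludedMiddle)
open import Axiom.DoubleNegationElimination using (em⇒dne)
open import Data.Nat using (ℕ; zero; suc; _≤_)
open import Data.List using (List; []; [_]; _++_; _∷ʳ_; foldl)
open import Data.List.Properties using (foldl-∷ʳ)
open import Data.Product using (Σ; _×_; _,_; proj₁; proj₂)
open import Function using (id)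
open import Function.Bundles using (_⇔_; mk⇔; module Equivalence)
open import Relation.Nullary using (¬_; Dec; yes; no)
open import Relation.Nullary.Decidable using (True; toWitness; fromWitness)
open import Relation.Binary.PropositionalEquality
  using (_≡_; refl; sym; trans; cong; subst; module ≡-Reasoning)

open Equivalence using (to; from)

Meets : Family → Family → Set₁
Meets 𝒳 𝒴 = (X : Move 𝒳) (Y : Move 𝒴) → Σ ℕ λ n → proj₁ X n × proj₁ Y n

Meets-sym : ∀ {𝒳 𝒴} → Meets 𝒳 𝒴 → Meets 𝒴 𝒳
Meets-sym meets Y X = let n , xn , yn = meets X Y in n , yn , xn

ChoiceFunction : Family → Set₁
ChoiceFunction 𝒴 = (Y : Move 𝒴) → Σ ℕ (proj₁ Y)

-- Subsets are predicates, so equal sets are only mutually included.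
Extensional : Family → Set₁
Extensional 𝒵 = ∀ S T → S ⊆ T → T ⊆ S → 𝒵 S → 𝒵 T

¬-extensional : ∀ {𝒵} → Extensional 𝒵 → Extensional (λ S → ¬ 𝒵 S)
¬-extensional ext S T S⊆T T⊆S S∉𝒵 T∈𝒵 = S∉𝒵 (ext T S T⊆S S⊆T T∈𝒵)

Complementary : Family → Family → Set₁
Complementary 𝒵 𝒲 = ∀ S → (¬ 𝒵 S) ⇔ 𝒲 S

¬-complementary : ∀ {𝒵} → Complementary 𝒵 (λ S → ¬ 𝒵 S)
¬-complementary _ = mk⇔ id id

Range-≗⊆ : ∀ {f g : ℕ → ℕ} → (∀ k → f k ≡ g k) → Range f ⊆ Range g
Range-≗⊆ f≗g m (k , fk≡m) = k , trans (sym (f≗g k)) fk≡m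

witnesses : ∀ {a b} {A : Set a} {B : A → Set b} → Dec (Σ A B) → List A
witnesses (yes (a , _)) = [ a ]
witnesses (no _) = []

witnesses-True : ∀ {a b} {A : Set a} {B : A → Set b} (d : Dec (Σ A B)) (t : True d) →
                 witnesses d ≡ [ proj₁ (toWitness t) ]
witnesses-True (yes _) _ = refl

IWins⇒IIWins : ∀ {𝒳 𝒴 𝒵 𝒲} → Meets 𝒳 𝒴 → (∀ S → ¬ 𝒵 S → 𝒲 S) →
               IWins 𝒳 𝒵 → IIWins 𝒴 𝒲
IWins⇒IIWins {𝒴 = 𝒴} {𝒲 = 𝒲} meets ¬𝒵⊆𝒲 (σ , σ-wins) = τ , τ-wins
  where
  answer : List ℕ → ChoiceFunction 𝒴
  answer ns Y = let n , _ , yn = meets (σ ns) Y in n , yn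

  ownMoves : List (Move 𝒴) → List ℕ
  ownMoves = foldl (λ ns Y → ns ∷ʳ proj₁ (answer ns Y)) []

  τ : StrategyII 𝒴
  τ Ys = answer (ownMoves Ys)

  τ-wins : (Ys : ℕ → Move 𝒴) → 𝒲 (Range (λ k → proj₁ (τ (prefix Ys k) (Ys k))))
  τ-wins Ys = ¬𝒵⊆𝒲 _ (σ-wins n legal)
    where
    n : ℕ → ℕ
    n k = proj₁ (τ (prefix Ys k) (Ys k))

    ownMoves-prefix : ∀ k → ownMoves (prefix Ys k) ≡ prefixℕ n k
    ownMoves-prefix zero = refl
    ownMoves-prefix (suc k) =
      trans (foldl-∷ʳ _ [] (Ys k) (prefix Ys k)) (cong (_∷ʳ n k) (ownMoves-prefix k))

    legal : ∀ k → proj₁ (σ (prefixℕ n k)) (n k)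
    legal k = subst (λ ns → proj₁ (σ ns) (n k)) (ownMoves-prefix k)
                    (proj₁ (proj₂ (meets (σ (ownMoves (prefix Ys k))) (Ys k))))

module _ (em : ExcludedMiddle (lsuc 0ℓ)) where

  -- The answer set of g is an existential over moves, a Set₁; excluded middle squashes
  -- it into a Subset.
  answers : ∀ {𝒴} → ChoiceFunction 𝒴 → Subset
  answers {𝒴} g n = True (em {Σ (Move 𝒴) λ Y → proj₁ (g Y) ≡ n})

  AnswersIn : Family → Family → Set₁
  AnswersIn 𝒴 𝒳 = (g : ChoiceFunction 𝒴) → 𝒳 (answers g)

  IIWins⇒IWins : ∀ {𝒳 𝒴 𝒵 𝒲} → AnswersIn 𝒴 𝒳 → Extensional 𝒲 →
                 (∀ S → 𝒲 S → ¬ 𝒵 S) → IIWins 𝒴 𝒲 → IWins 𝒳 𝒵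
  IIWins⇒IWins {𝒳} {𝒴} {𝒵} answers∈𝒳 ext𝒲 𝒲⊆¬𝒵 (τ , τ-wins) = σ , σ-wins
    where
    -- Every number of a play of σ is τ's answer to some move; recovering these moves
    -- reconstructs the position τ is in.
    opponentMoves : List ℕ → List (Move 𝒴)
    opponentMoves = foldl (λ Ys n → Ys ++ witnesses (em {Σ (Move 𝒴) λ Y → proj₁ (τ Ys Y) ≡ n})) []

    σ : StrategyI 𝒳
    σ ns = answers (τ (opponentMoves ns)) , answers∈𝒳 (τ (opponentMoves ns))

    σ-wins : (n : ℕ → ℕ) → (∀ k → proj₁ (σ (prefixℕ n k)) (n k)) → ¬ 𝒵 (Range n)
    σ-wins n legal = 𝒲⊆¬𝒵 _ (ext𝒲 _ _ (Range-≗⊆ τ-answers) (Range-≗⊆ (λ k → sym (τ-answers k))) (τ-wins Ys))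
      where
      Ys : ℕ → Move 𝒴
      Ys k = proj₁ (toWitness (legal k))

      opponentMoves-prefix : ∀ k → opponentMoves (prefixℕ n k) ≡ prefix Ys k
      opponentMoves-prefix zero = refl
      opponentMoves-prefix (suc k) = begin
        opponentMoves (prefixℕ n k ∷ʳ n k)          ≡⟨ foldl-∷ʳ _ [] (n k) (prefixℕ n k) ⟩
        opponentMoves (prefixℕ n k) ++ witnesses _  ≡⟨ cong (opponentMoves (prefixℕ n k) ++_) (witnesses-True _ (legal k)) ⟩
        opponentMoves (prefixℕ n k) ∷ʳ Ys k         ≡⟨ cong (_∷ʳ Ys k) (opponentMoves-prefix k) ⟩
        prefix Ys k ∷ʳ Ys k                         ∎
        where open ≡-Reasoning

      τ-answers : ∀ k → proj₁ (τ (prefix Ys k) (Ys k)) ≡ n k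
      τ-answers k = trans (cong (λ Ys′ → proj₁ (τ Ys′ (Ys k))) (sym (opponentMoves-prefix k)))
                          (proj₂ (toWitness (legal k)))

  complementary-sym : ∀ {𝒵 𝒲} → Complementary 𝒵 𝒲 → Complementary 𝒲 𝒵
  complementary-sym c S =
    mk⇔ (λ S∉𝒲 → em⇒dne em λ S∉𝒵 → S∉𝒲 (to (c S) S∉𝒵)) (λ S∈𝒵 S∈𝒲 → from (c S) S∈𝒲 S∈𝒵)

  dual : ∀ {𝒳 𝒴 𝒵 𝒲} → Meets 𝒳 𝒴 → AnswersIn 𝒴 𝒳 → AnswersIn 𝒳 𝒴 →
         Extensional 𝒵 → Extensional 𝒲 → Complementary 𝒵 𝒲 → Dual 𝒳 𝒵 𝒴 𝒲
  dual {𝒵 = 𝒵} {𝒲} meets 𝒴⇝𝒳 𝒳⇝𝒴 ext𝒵 ext𝒲 c =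
    mk⇔ (IWins⇒IIWins meets (λ S → to (c S))) (IIWins⇒IWins 𝒴⇝𝒳 ext𝒲 (λ S → from (c S))) ,
    mk⇔ (IIWins⇒IWins 𝒳⇝𝒴 ext𝒵 (λ S → from (c′ S))) (IWins⇒IIWins (Meets-sym meets) (λ S → to (c′ S)))
    where
    c′ : Complementary 𝒲 𝒵
    c′ = complementary-sym c

Infinite-mono : ∀ {X Y} → X ⊆ Y → Infinite X → Infinite Y
Infinite-mono X⊆Y inf m = let n , m≤n , xn = inf m in n , m≤n , X⊆Y n xn

¬Infinite⇒bounded : ExcludedMiddle 0ℓ → ∀ {X} → ¬ Infinite X →
                    Σ ℕ λ m → ∀ n → m ≤ n → ¬ X n
¬Infinite⇒bounded em ¬inf =
  dne λ unbounded → ¬inf λ m → dne λ nothingAbove → unbounded (m , λ n m≤n xn → nothingAbove (n , m≤n , xn))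
  where dne = em⇒dne em

Plus-extensional : ∀ {𝓕} → Extensional (Plus 𝓕)
Plus-extensional S T S⊆T _ S∈𝓕⁺ Y Y∈𝓕 = Infinite-mono (λ n (sn , yn) → S⊆T n sn , yn) (S∈𝓕⁺ Y Y∈𝓕)

module _ {𝓕 : Family} (isFilter : IsFilter 𝓕) where
  open IsFilter isFilter

  𝓕-extensional : Extensional 𝓕
  𝓕-extensional S T S⊆T _ = ⊇-closed S T S⊆T

  tail∈𝓕 : ∀ {Y} m → 𝓕 Y → 𝓕 (Y ∩ (m ≤_))
  tail∈𝓕 {Y} m Y∈𝓕 = ∩-closed Y (m ≤_) Y∈𝓕 (cofinite (m ≤_) (m , λ _ → id))

  Plus-meets : Meets (Plus 𝓕) 𝓕
  Plus-meets (X , X∈𝓕⁺) (Y , Y∈𝓕) = let n , _ , xyn = X∈𝓕⁺ Y Y∈𝓕 0 in n , xyn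

  finiteTrace⇒∁∈𝓕 : ExcludedMiddle 0ℓ → ∀ {X Y} → 𝓕 Y → ¬ Infinite (X ∩ Y) → 𝓕 (λ n → ¬ X n)
  finiteTrace⇒∁∈𝓕 em₀ {X} {Y} Y∈𝓕 finite =
    let m , beyond = ¬Infinite⇒bounded em₀ finite
    in ⊇-closed (Y ∩ (m ≤_)) _ (λ n (yn , m≤n) xn → beyond n m≤n (xn , yn)) (tail∈𝓕 m Y∈𝓕)

  ∉Plus⇒∁∈𝓕 : ExcludedMiddle 0ℓ → ExcludedMiddle (lsuc 0ℓ) →
              ∀ {X} → ¬ Plus 𝓕 X → 𝓕 (λ n → ¬ X n)
  ∉Plus⇒∁∈𝓕 em₀ em₁ {X} X∉𝓕⁺ =
    let Y , Y∈𝓕 , finite = finiteTrace in finiteTrace⇒∁∈𝓕 em₀ Y∈𝓕 finite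
    where
    finiteTrace : Σ Subset λ Y → 𝓕 Y × ¬ Infinite (X ∩ Y)
    finiteTrace = em⇒dne em₁ λ noTrace →
      X∉𝓕⁺ λ Y Y∈𝓕 → em⇒dne em₀ λ finite → noTrace (Y , Y∈𝓕 , finite)

  answers∈Plus : (em : ExcludedMiddle (lsuc 0ℓ)) → AnswersIn em 𝓕 (Plus 𝓕)
  answers∈Plus em g Y Y∈𝓕 m =
    let n , yn , m≤n = g tail in n , m≤n , fromWitness (tail , refl) , yn
    where
    tail : Move 𝓕
    tail = Y ∩ (m ≤_) , tail∈𝓕 m Y∈𝓕

  answers∈𝓕 : ExcludedMiddle 0ℓ → (em : ExcludedMiddle (lsuc 0ℓ)) → AnswersIn em (Plus 𝓕) 𝓕
  answers∈𝓕 em₀ em g = ⊇-closed _ _ (λ _ → em⇒dne em₀) (∉Plus⇒∁∈𝓕 em₀ em ∁S∉𝓕⁺)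
    where
    ∁S∉𝓕⁺ : ¬ Plus 𝓕 (λ n → ¬ answers em g n)
    ∁S∉𝓕⁺ ∁S∈𝓕⁺ = proj₂ (g (_ , ∁S∈𝓕⁺)) (fromWitness ((_ , ∁S∈𝓕⁺) , refl))

theorem2p10 : ExcludedMiddle 0ℓ → ExcludedMiddle (lsuc 0ℓ) →
    (𝓕 : Family) → IsFilter 𝓕 →
      Dual (Plus 𝓕) 𝓕 𝓕 (Compl 𝓕)
      × Dual (Plus 𝓕) (Plus 𝓕) 𝓕 (Star 𝓕)
      × Dual (Plus 𝓕) (Compl 𝓕) 𝓕 𝓕
      × Dual (Plus 𝓕) (Star 𝓕) 𝓕 (Plus 𝓕)
theorem2p10 em₀ em₁ 𝓕 isFilter =
  game 𝓕-ext (¬-extensional 𝓕-ext) (¬-complementary {𝓕}) ,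
  game Plus-extensional (¬-extensional Plus-extensional) (¬-complementary {Plus 𝓕}) ,
  game (¬-extensional 𝓕-ext) 𝓕-ext (complementary-sym em₁ (¬-complementary {𝓕})) ,
  game (¬-extensional Plus-extensional) Plus-extensional (complementary-sym em₁ (¬-complementary {Plus 𝓕}))
  where
  𝓕-ext : Extensional 𝓕
  𝓕-ext = 𝓕-extensional isFilter

  game : ∀ {𝒵 𝒲} → Extensional 𝒵 → Extensional 𝒲 → Complementary 𝒵 𝒲 → Dual (Plus 𝓕) 𝒵 𝓕 𝒲
  game = dual em₁ (Plus-meets isFilter) (answers∈Plus isFilter em₁) (answers∈𝓕 isFilter em₀ em₁)
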